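{- For every sufficiently large $n$ there is a class $\mathcal{G}$ of instances of metric $3$-DOAT such that: (i) in each instance $\langle T, c\rangle \in \mathcal{G}$, $T$ is a tree with $\Theta(n)$ vertices and all tree-edge and shortcut costs assigned by $c$ are positive integers; (ii) no algorithm can decide, using $o(n^2)$ oracle queries, whether an input instance $\langle T, c\rangle$ from $\mathcal{G}$ admits a set $S$ of $3$ shortcuts with $\mathrm{diam}(T+S) \le 9$.
   Context: An instance of $k$-DOAT ($k$-Diameter-Optimally Augmenting Tree) is a pair $\langle T, c\rangle$ where $T$ is a tree on $n$ vertices and $c$ assigns a non-negative cost $c(u,v)$ to every pair of distinct vertices $u,v$ of $T$. The costs of tree edges are also given by $c$. The function $c$ is unknown to the algorithm, which accesses it through an oracle that, given two distinct vertices $u,v$, returns $c(u,v)$ in constant time (one query). A shortcut is a pair of distinct vertices of $T$ not joined by a tree edge. For a set $S$ of shortcuts, $T+S$ is the graph obtained by adding the edges of $S$ to $T$, with every edge $(u,v)$ having cost $c(u,v)$. The diameter of an edge-weighted graph $G$ is $\mathrm{diam}(G)=\max_{u,v\in V(G)} d_G(u,v)$, where $d_G$ is the shortest-path distance with respect to the edge costs. The goal of $k$-DOAT is to find a set $S$ of $k$ shortcuts minimizing $\mathrm{diam}(T+S)$. The instance is metric if $c(u,v)\le c(u,w)+c(w,v)$ for every three distinct vertices $u,v,w$; metric $k$-DOAT is $k$-DOAT restricted to metric instances. -}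

module Defs where

open import Data.Nat using (ℕ; zero; suc; _+_; _*_; _≤_)
open import Data.Fin using (Fin; fromℕ; inject₁)
open import Data.Bool using (Bool; true)
open import Data.Product using (Σ; _×_; _,_; proj₁; proj₂; ∃)
open import Data.Sum using (_⊎_)
open import Relation.Binary.PropositionalEquality using (_≡_; _≢_)
open import Relation.Nullary using (¬_)

-- Trees on vertex set Fin m (m ≥ 1), built by repeatedly attaching a
-- new leaf (vertex index m) to an existing vertex.  Every finite tree
-- arises this way (up to relabelling of vertices).

data Tree : ℕ → Set where
  single : Tree 1
  grow   : ∀ {m} → Tree m → Fin m → Tree (suc m)

data TreeEdge : ∀ {m} → Tree m → Fin m → Fin m → Set where
  old  : ∀ {m} {t : Tree m} {p : Fin m} {u v : Fin m} →
         TreeEdge t u v → TreeEdge (grow t p) (inject₁ u) (inject₁ v)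
  newˡ : ∀ {m} {t : Tree m} {p : Fin m} →
         TreeEdge (grow t p) (fromℕ m) (inject₁ p)
  newʳ : ∀ {m} {t : Tree m} {p : Fin m} →
         TreeEdge (grow t p) (inject₁ p) (fromℕ m)

-- cost functions (the oracle c); c u u is irrelevant/unused
Cost : ℕ → Set
Cost m = Fin m → Fin m → ℕ

Instance : Set
Instance = Σ ℕ λ m → Tree m × Cost m

size : Instance → ℕ
size I = proj₁ I

Symmetric : ∀ {m} → Cost m → Set
Symmetric {m} c = (u v : Fin m) → c u v ≡ c v u

Metric : ∀ {m} → Cost m → Set
Metric {m} c = (u v w : Fin m) → u ≢ v → u ≢ w → w ≢ v → c u v ≤ c u w + c w v

PositiveCosts : ∀ {m} → Cost m → Set
PositiveCosts {m} c = (u v : Fin m) → u ≢ v → 1 ≤ c u v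

GoodInstance : Instance → Set
GoodInstance (m , T , c) = Symmetric c × Metric c × PositiveCosts c

IsShortcut : ∀ {m} → Tree m → Fin m × Fin m → Set
IsShortcut T (u , v) = u ≢ v × ¬ TreeEdge T u v

swap : ∀ {m} → Fin m × Fin m → Fin m × Fin m
swap (u , v) = (v , u)

ShortcutSet : ∀ {m} → Tree m → ℕ → Set
ShortcutSet {m} T k =
  Σ (Fin k → Fin m × Fin m) λ S →
    ((i : Fin k) → IsShortcut T (S i)) ×
    ((i j : Fin k) → i ≢ j → (S i ≢ S j) × (S i ≢ swap (S j)))

AugEdge : ∀ {m} (T : Tree m) {k} → ShortcutSet T k → Fin m → Fin m → Set
AugEdge T {k} (S , _) u v =
  TreeEdge T u v ⊎ (Σ (Fin k) λ i → (S i ≡ (u , v)) ⊎ (S i ≡ (v , u)))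

data Walk {m} (E : Fin m → Fin m → Set) (c : Cost m) : Fin m → Fin m → ℕ → Set where
  here : ∀ {u} → Walk E c u u 0
  step : ∀ {u v w ℓ} → E u v → Walk E c v w ℓ → Walk E c u w (c u v + ℓ)

DiamAtMost : ∀ {m} → (Fin m → Fin m → Set) → Cost m → ℕ → Set
DiamAtMost {m} E c D = (u v : Fin m) → Σ ℕ λ ℓ → Walk E c u v ℓ × ℓ ≤ D

Admits : ℕ → ℕ → Instance → Set
Admits k D (m , T , c) = Σ (ShortcutSet T k) λ S → DiamAtMost (AugEdge T S) c D

-- Query algorithms: the algorithm knows T and accesses c through an
-- oracle.  For a given tree it is an adaptive decision tree whose
-- internal nodes query c(u,v) and branch on the answer.

data DTree (m : ℕ) : Set where
  answer : Bool → DTree m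
  query  : Fin m → Fin m → (ℕ → DTree m) → DTree m

run : ∀ {m} → DTree m → Cost m → Bool × ℕ
run (answer b)    c = b , 0
run (query u v k) c with run (k (c u v)) c
... | b , q = b , suc q

Algorithm : Set
Algorithm = (m : ℕ) → Tree m → DTree m

runAlg : Algorithm → Instance → Bool × ℕ
runAlg A (m , T , c) = run (A m T) c

DecidesWith : Algorithm → (Instance → Set) → ℕ → ℕ → ℕ → Set
DecidesWith A G k D Q = (I : Instance) → G I →
  (proj₂ (runAlg A I) ≤ Q) ×
  (proj₁ (runAlg A I) ≡ true → Admits k D I) ×
  (Admits k D I → proj₁ (runAlg A I) ≡ true)

LittleOSquare : (ℕ → ℕ) → Set
LittleOSquare q = (r : ℕ) → 1 ≤ r → Σ ℕ λ N → (n : ℕ) → N ≤ n → r * q n ≤ n * n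

-- All instances live on one tree: a root z with children h₁, h₂, w₁, w₂, and n leaves
-- below each hub hᵢ. Costs depend only on the groups of the endpoints (costTable), except in the
-- planted instance for (a , b), where the a-th leaf α below h₁ and the b-th leaf β below h₂ are
-- joined at cost 3 instead of 4. With the shortcuts w₁α, w₂β, αβ every vertex is close enough to
-- α or to β, so a planted instance has diameter at most 9. In the base instance pick leaves α below h₁ and
-- β below h₂ that no shortcut touches (n ≥ 7 > 6 endpoints); the only way in is through their hub,
-- and the costs force a shortcut from each wᵢ to its own side and one from each side to the other.
-- Three shortcuts can do this only as w₁p, pq, qw₂ with leaves p, q, and then d(w₁ , w₂) ≥ 10.
-- A planted instance differs from the base one in a single pair, so fewer than n² queries miss the
-- planted pair of some (a , b), and the algorithm cannot tell that instance from the base one.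

module Submission where

open import Defs
open import Data.Bool using (true; if_then_else_)
open import Data.Empty using (⊥-elim)
open import Data.Fin as Fin using (Fin; toℕ; fromℕ<; inject₁; lower₁; remQuot; combine)
  renaming (zero to fzero; suc to fsuc)
open import Data.Fin.Properties as Finₚ using (toℕ-injective; toℕ-fromℕ; toℕ-fromℕ<; toℕ-inject₁; toℕ-lower₁; inject₁-lower₁; toℕ<n; pigeonhole; ¬∀⟶∃¬; combine-remQuot)
open import Data.List using (List; []; _∷_; length; lookup)
open import Data.List.Relation.Unary.All as All using (All; []; _∷_)
open import Data.List.Relation.Unary.All.Properties using (¬Any⇒All¬)
open import Data.List.Relation.Unary.Any as Any using (Any; any?)
open import Data.List.Relation.Unary.Any.Properties using (lookup-index)
open import Data.Nat as ℕ using (ℕ; zero; suc; _+_; _*_; _≤_; _<_; z≤n; s≤s; _≤?_; _<?_)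
open import Data.Nat.Properties
  using (+-assoc; +-identityʳ; +-comm; +-suc; +-monoʳ-≤; +-monoˡ-≤; +-mono-≤; +-cancelˡ-≡; suc-injective; ≤-refl; ≤-reflexive;
         ≤-trans; ≤-pred; ≤-<-trans; <-≤-trans; <-irrefl; <-cmp; <⇒≤; <⇒≱; <⇒≢; m≤m+n; m≤n+m; m<m+n; m+n≮m; module ≤-Reasoning)
open import Data.Product as Product using (Σ; ∃; ∃₂; _×_; _,_; proj₁; proj₂; uncurry)
open import Data.Product.Properties using (≡-dec)
open import Data.Sum as Sum using (_⊎_; inj₁; inj₂; [_,_]′)
open import Data.Vec as Vec using (Vec; []; _∷_)
open import Function using (_∘_)
open import Relation.Binary.Definitions using (DecidableEquality; tri<; tri≈; tri>)
open import Relation.Binary.PropositionalEquality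
open import Relation.Nullary using (¬_; Dec; yes; no; does; contradiction)
open import Relation.Nullary.Decidable using (map′; ¬?; _→-dec_; _×-dec_; _⊎-dec_; from-yes; decidable-stable)
open import Relation.Unary using (Decidable)

module FiniteType {A : Set} {k : ℕ} (enum : Fin k → A) (index : A → Fin k)
                  (enum-index : ∀ a → enum (index a) ≡ a) where

  all? : {P : A → Set} → Decidable P → Dec (∀ a → P a)
  all? {P} P? = map′ (λ h a → subst P (enum-index a) (h (index a))) (λ h → h ∘ enum)
                     (Finₚ.all? (P? ∘ enum))

  _≟_ : DecidableEquality A
  a ≟ b = map′ (λ e → trans (sym (enum-index a)) (trans (cong enum e) (enum-index b)))
               (cong index) (index a Finₚ.≟ index b)

-- Finitely checkable facts are proved by running a decision procedure; they are opaque so that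
-- their uses never unfold that procedure.
opaque
  fin3-cover : (i j k l : Fin 3) → i ≢ j → i ≢ k → j ≢ k → l ≡ i ⊎ l ≡ j ⊎ l ≡ k
  fin3-cover = from-yes (Finₚ.all? {n = 3} λ i → Finₚ.all? λ j → Finₚ.all? λ k → Finₚ.all? λ l →
    ¬? (i Finₚ.≟ j) →-dec ¬? (i Finₚ.≟ k) →-dec ¬? (j Finₚ.≟ k) →-dec
    ((l Finₚ.≟ i) ⊎-dec (l Finₚ.≟ j) ⊎-dec (l Finₚ.≟ k)))

unmatched : ∀ {N} {X : Set} (R : Fin N → X → Set) → (∀ i x → Dec (R i x)) →
            (∀ {i j x} → R i x → R j x → i ≡ j) →
            (xs : List X) → length xs < N → ∃ λ i → All (¬_ ∘ R i) xs
unmatched {N} R R? R-unique xs xs<N with Finₚ.all? (λ i → any? (R? i) xs)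
... | no ¬all-hit = Product.map₂ (¬Any⇒All¬ xs) (¬∀⟶∃¬ N _ (λ i → any? (R? i) xs) ¬all-hit)
... | yes hit with pigeonhole xs<N (Any.index ∘ hit)
...   | i , j , i<j , same-index =
        contradiction (R-unique (lookup-index (hit i)) (subst (R j ∘ lookup xs) (sym same-index) (lookup-index (hit j))))
                      (<⇒≢ i<j ∘ cong toℕ)

queries : ∀ {m} → DTree m → Cost m → List (Fin m × Fin m)
queries (answer _) c = []
queries (query u v k) c = (u , v) ∷ queries (k (c u v)) c

run-count≡length-queries : ∀ {m} (D : DTree m) c → proj₂ (run D c) ≡ length (queries D c)
run-count≡length-queries (answer _) c = refl
run-count≡length-queries (query u v k) c with run (k (c u v)) c | run-count≡length-queries (k (c u v)) c
... | _ , count | count≡length = cong suc count≡length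

run-agrees : ∀ {m} (D : DTree m) c c′ → All (λ q → c′ (proj₁ q) (proj₂ q) ≡ c (proj₁ q) (proj₂ q)) (queries D c) →
             run D c′ ≡ run D c
run-agrees (answer _) c c′ [] = refl
run-agrees (query u v k) c c′ (same ∷ rest) rewrite same | run-agrees (k (c u v)) c c′ rest = refl

adversary : ∀ {m N} (D : DTree m) (c₀ : Cost m) (c : Fin N → Cost m) →
            (∀ {i j u v} → c i u v ≢ c₀ u v → c j u v ≢ c₀ u v → i ≡ j) →
            proj₂ (run D c₀) < N → ∃ λ i → run D (c i) ≡ run D c₀
adversary D c₀ c separated fast with unmatched (λ i q → c i (proj₁ q) (proj₂ q) ≢ c₀ (proj₁ q) (proj₂ q))
    (λ i q → ¬? (c i (proj₁ q) (proj₂ q) ℕ.≟ c₀ (proj₁ q) (proj₂ q))) separated (queries D c₀)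
    (subst (_< _) (run-count≡length-queries D c₀) fast)
... | i , agree = i , run-agrees D c₀ (c i) (All.map (decidable-stable (_ ℕ.≟ _)) agree)

module _ {m} {E : Fin m → Fin m → Set} {c : Cost m} where

  walk-++ : ∀ {u v w ℓ₁ ℓ₂} → Walk E c u v ℓ₁ → Walk E c v w ℓ₂ → Walk E c u w (ℓ₁ + ℓ₂)
  walk-++ here q = q
  walk-++ (step {u} {v} {ℓ = ℓ} e p) q = subst (Walk E c u _) (sym (+-assoc (c u v) ℓ _)) (step e (walk-++ p q))

  walk-reverse : (∀ {u v} → E u v → E v u) → (∀ u v → c u v ≡ c v u) →
                 ∀ {u v ℓ} → Walk E c u v ℓ → Walk E c v u ℓ
  walk-reverse E-sym c-sym here = here
  walk-reverse E-sym c-sym (step {u} {v} {ℓ = ℓ} e p) =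
    subst (Walk E c _ u) (trans (cong (ℓ +_) (trans (+-identityʳ _) (c-sym v u))) (+-comm ℓ (c u v)))
          (walk-++ (walk-reverse E-sym c-sym p) (step (E-sym e) here))

  walk-uncons : ∀ {s t ℓ} → Walk E c s t ℓ → s ≢ t →
                ∃ λ v → E s v × ∃ λ ℓ′ → Walk E c v t ℓ′ × c s v + ℓ′ ≡ ℓ
  walk-uncons here s≢t = contradiction refl s≢t
  walk-uncons (step e p) _ = _ , e , _ , p , refl

  walk-potential : (f : Fin m → ℕ) → (∀ {u v} → E u v → f u ≤ c u v + f v) →
                   ∀ {s t ℓ} → Walk E c s t ℓ → f s ≤ ℓ + f t
  walk-potential f f-step here = ≤-refl
  walk-potential f f-step (step {u} {v} {ℓ = ℓ} e p) = begin
    f u               ≤⟨ f-step e ⟩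
    c u v + f v       ≤⟨ +-monoʳ-≤ (c u v) (walk-potential f f-step p) ⟩
    c u v + (ℓ + _)   ≡⟨ +-assoc (c u v) ℓ _ ⟨
    c u v + ℓ + _     ∎
    where open ≤-Reasoning

  module _ (triangle : ∀ u v w → c u v ≤ c u w + c w v) (c-refl : ∀ u → c u u ≡ 0) where

    cost-≤-walk : ∀ {s t ℓ} → Walk E c s t ℓ → c s t ≤ ℓ
    cost-≤-walk {s} {t} {ℓ} p = begin
      c s t      ≤⟨ walk-potential (λ u → c u t) (λ {u} {v} _ → triangle u t v) p ⟩
      ℓ + c t t  ≡⟨ cong (ℓ +_) (c-refl t) ⟩
      ℓ + 0      ≡⟨ +-identityʳ ℓ ⟩
      ℓ          ∎
      where open ≤-Reasoning

    cost-via-≤-walk : ∀ {h p} → (∀ {u} → E u h → u ≡ p) →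
                      ∀ {s ℓ} → Walk E c s h ℓ → s ≢ h → c s p + c p h ≤ ℓ
    cost-via-≤-walk {h} {p} only-p {s} {ℓ} walk s≢h = begin
      c s p + c p h  ≡⟨ via-≢ s≢h ⟨
      f s            ≤⟨ walk-potential f f-step walk ⟩
      ℓ + f h        ≡⟨ cong (ℓ +_) via-≡ ⟩
      ℓ + 0          ≡⟨ +-identityʳ ℓ ⟩
      ℓ              ∎
      where
      open ≤-Reasoning
      f : Fin m → ℕ
      f u = if does (u Finₚ.≟ h) then 0 else c u p + c p h
      via-≡ : f h ≡ 0
      via-≡ with h Finₚ.≟ h
      ... | yes _ = refl
      ... | no h≢h = contradiction refl h≢h
      via-≢ : ∀ {u} → u ≢ h → f u ≡ c u p + c p h
      via-≢ {u} u≢h with u Finₚ.≟ h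
      ... | yes u≡h = contradiction u≡h u≢h
      ... | no _ = refl
      f-step : ∀ {u v} → E u v → f u ≤ c u v + f v
      f-step {u} {v} e with u Finₚ.≟ h | v Finₚ.≟ h
      ... | yes _ | _ = z≤n
      ... | no _ | yes refl rewrite only-p e | c-refl p = m≤m+n (c p v) 0
      ... | no _ | no _ = begin
        c u p + c p h          ≤⟨ +-monoˡ-≤ (c p h) (triangle u p v) ⟩
        c u v + c v p + c p h  ≡⟨ +-assoc (c u v) (c v p) (c p h) ⟩
        c u v + (c v p + c p h) ∎

tree-edge-sym : ∀ {m} {T : Tree m} {u v} → TreeEdge T u v → TreeEdge T v u
tree-edge-sym (old e) = old (tree-edge-sym e)
tree-edge-sym newˡ = newʳ
tree-edge-sym newʳ = newˡ

inject₁-view : ∀ {m} (w : Fin (suc (suc m))) → toℕ w < suc m →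
               ∃ λ w′ → w ≡ inject₁ w′ × toℕ w′ ≡ toℕ w
inject₁-view {m} w w< = lower₁ w w≢ , sym (inject₁-lower₁ w w≢) , toℕ-lower₁ w w≢
  where
  w≢ : suc m ≢ toℕ w
  w≢ e = <-irrefl (sym e) w<

aug-edge-sym : ∀ {m} {T : Tree m} {k} {S : ShortcutSet T k} {u v} → AugEdge T S u v → AugEdge T S v u
aug-edge-sym (inj₁ e) = inj₁ (tree-edge-sym e)
aug-edge-sym (inj₂ (i , inj₁ e)) = inj₂ (i , inj₂ e)
aug-edge-sym (inj₂ (i , inj₂ e)) = inj₂ (i , inj₁ e)

module ParentTree (parent : (i : ℕ) → Fin (suc i)) where

  tree : (m : ℕ) → Tree (suc m)
  tree zero = single
  tree (suc m) = grow (tree m) (parent m)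

  ChildOf : ℕ → ℕ → Set
  ChildOf u v = ∃ λ i → u ≡ suc i × v ≡ toℕ (parent i)

  tree-edge⇒child : ∀ m {u v} → TreeEdge (tree m) u v → ChildOf (toℕ u) (toℕ v) ⊎ ChildOf (toℕ v) (toℕ u)
  tree-edge⇒child (suc m) (old {u = u} {v = v} e) rewrite toℕ-inject₁ u | toℕ-inject₁ v = tree-edge⇒child m e
  tree-edge⇒child (suc m) newˡ rewrite toℕ-fromℕ (suc m) | toℕ-inject₁ (parent m) = inj₁ (m , refl , refl)
  tree-edge⇒child (suc m) newʳ rewrite toℕ-fromℕ (suc m) | toℕ-inject₁ (parent m) = inj₂ (m , refl , refl)

  tree-edge-irreflexive : ∀ m {u} → ¬ TreeEdge (tree m) u u
  tree-edge-irreflexive m e with tree-edge⇒child m e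
  ... | inj₁ (i , u≡ , u≡′) = <-irrefl (trans (sym u≡′) u≡) (toℕ<n (parent i))
  ... | inj₂ (i , u≡ , u≡′) = <-irrefl (trans (sym u≡′) u≡) (toℕ<n (parent i))

  child⇒tree-edge : ∀ m {u v : Fin (suc m)} → ChildOf (toℕ u) (toℕ v) → TreeEdge (tree m) u v
  child⇒tree-edge zero {fzero} (_ , () , _)
  child⇒tree-edge (suc m) {u} {v} (i , u≡ , v≡) with <-cmp i m
  ... | tri≈ _ refl _ rewrite toℕ-injective {i = u} (trans u≡ (sym (toℕ-fromℕ (suc i))))
                            | toℕ-injective {i = v} (trans v≡ (sym (toℕ-inject₁ (parent i)))) = newˡ
  ... | tri> _ _ i>m = contradiction (≤-pred (≤-pred (subst (_< suc (suc m)) u≡ (toℕ<n u)))) (<⇒≱ i>m)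
  ... | tri< i<m _ _ with inject₁-view u (subst (_< suc m) (sym u≡) (s≤s i<m))
                       | inject₁-view v (subst (_< suc m) (sym v≡) (≤-trans (toℕ<n (parent i)) (s≤s (<⇒≤ i<m))))
  ...   | u′ , refl , u′≡ | v′ , refl , v′≡ = old (child⇒tree-edge m (i , trans u′≡ u≡ , trans v′≡ v≡))

Joins : {A : Set} → A × A → A → A → Set
Joins e u v = e ≡ (u , v) ⊎ e ≡ (v , u)

joins-match : ∀ {A : Set} {e : A × A} {u v u′ v′} → Joins e u v → Joins e u′ v′ →
              (u ≡ u′ × v ≡ v′) ⊎ (u ≡ v′ × v ≡ u′)
joins-match (inj₁ refl) (inj₁ refl) = inj₁ (refl , refl)
joins-match (inj₁ refl) (inj₂ refl) = inj₂ (refl , refl)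
joins-match (inj₂ refl) (inj₁ refl) = inj₂ (refl , refl)
joins-match (inj₂ refl) (inj₂ refl) = inj₁ (refl , refl)

joins-same-ends : ∀ {A : Set} {e e′ : A × A} {u v} → Joins e u v → Joins e′ u v → e ≡ e′ ⊎ e ≡ Product.swap e′
joins-same-ends (inj₁ refl) (inj₁ refl) = inj₁ refl
joins-same-ends (inj₁ refl) (inj₂ refl) = inj₂ refl
joins-same-ends (inj₂ refl) (inj₁ refl) = inj₂ refl
joins-same-ends (inj₂ refl) (inj₂ refl) = inj₁ refl

joins-sym : ∀ {A : Set} {e : A × A} {a b} → Joins e a b → Joins e b a
joins-sym (inj₁ e) = inj₂ e
joins-sym (inj₂ e) = inj₁ e

joins-endpoint : ∀ {A : Set} {e : A × A} {a b c d} → Joins e a b → Joins e c d → a ≡ c ⊎ a ≡ d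
joins-endpoint jab jcd with joins-match jab jcd
... | inj₁ (a≡c , _) = inj₁ a≡c
... | inj₂ (a≡d , _) = inj₂ a≡d

joins-other-end : ∀ {A : Set} {e : A × A} {a b c} → Joins e a b → Joins e a c → a ≢ c → b ≡ c
joins-other-end jab jac a≢c with joins-match jab jac
... | inj₁ (_ , b≡c) = b≡c
... | inj₂ (a≡c , _) = contradiction a≡c a≢c

module _ {m} {R : Set} (t : R → R → ℕ) (label : Fin m → R) where

  labelledCost : Cost m
  labelledCost u v = if does (u Finₚ.≟ v) then 0 else t (label u) (label v)

  labelledCost-refl : ∀ u → labelledCost u u ≡ 0
  labelledCost-refl u with u Finₚ.≟ u
  ... | yes _ = refl
  ... | no u≢u = contradiction refl u≢u

  labelledCost-≢ : ∀ {u v} → u ≢ v → labelledCost u v ≡ t (label u) (label v)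
  labelledCost-≢ {u} {v} u≢v with u Finₚ.≟ v
  ... | yes u≡v = contradiction u≡v u≢v
  ... | no _ = refl

  labelledCost-≤ : ∀ u v → labelledCost u v ≤ t (label u) (label v)
  labelledCost-≤ u v with u Finₚ.≟ v
  ... | yes _ = z≤n
  ... | no _ = ≤-refl

  labelledCost-sym : (∀ r s → t r s ≡ t s r) → Symmetric labelledCost
  labelledCost-sym t-sym u v with u Finₚ.≟ v | v Finₚ.≟ u
  ... | yes _ | yes _ = refl
  ... | no _ | no _ = t-sym (label u) (label v)
  ... | yes refl | no v≢u = contradiction refl v≢u
  ... | no u≢v | yes refl = contradiction refl u≢v

  labelledCost-triangle : (∀ r s q → t r s ≤ t r q + t q s) →
                          ∀ u v w → labelledCost u v ≤ labelledCost u w + labelledCost w v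
  labelledCost-triangle t-tri u v w = by-cases (u Finₚ.≟ v) (u Finₚ.≟ w) (w Finₚ.≟ v)
    where
    by-cases : Dec (u ≡ v) → Dec (u ≡ w) → Dec (w ≡ v) →
               labelledCost u v ≤ labelledCost u w + labelledCost w v
    by-cases (yes refl) _ _ rewrite labelledCost-refl u = z≤n
    by-cases (no _) (yes refl) _ rewrite labelledCost-refl u = ≤-refl
    by-cases (no _) (no _) (yes refl) rewrite labelledCost-refl w = m≤m+n _ 0
    by-cases (no u≢v) (no u≢w) (no w≢v)
      rewrite labelledCost-≢ u≢v | labelledCost-≢ u≢w | labelledCost-≢ w≢v = t-tri (label u) (label v) (label w)

  labelledCost-good : (∀ r s → t r s ≡ t s r) → (∀ r s q → t r s ≤ t r q + t q s) → (∀ r s → 1 ≤ t r s) →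
                      (T : Tree m) → GoodInstance (m , T , labelledCost)
  labelledCost-good t-sym t-tri t-pos T =
      labelledCost-sym t-sym
    , (λ u v w _ _ _ → labelledCost-triangle t-tri u v w)
    , (λ u v u≢v → subst (1 ≤_) (sym (labelledCost-≢ u≢v)) (t-pos (label u) (label v)))

data Group : Set where
  Z H₁ H₂ W₁ W₂ L₁ L₂ : Group

groupIndex : Group → Fin 7
groupIndex Z = Fin.# 0
groupIndex H₁ = Fin.# 1
groupIndex H₂ = Fin.# 2
groupIndex W₁ = Fin.# 3
groupIndex W₂ = Fin.# 4
groupIndex L₁ = Fin.# 5
groupIndex L₂ = Fin.# 6

groups : Vec Group 7
groups = Z ∷ H₁ ∷ H₂ ∷ W₁ ∷ W₂ ∷ L₁ ∷ L₂ ∷ []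

lookup-groupIndex : ∀ γ → Vec.lookup groups (groupIndex γ) ≡ γ
lookup-groupIndex Z = refl
lookup-groupIndex H₁ = refl
lookup-groupIndex H₂ = refl
lookup-groupIndex W₁ = refl
lookup-groupIndex W₂ = refl
lookup-groupIndex L₁ = refl
lookup-groupIndex L₂ = refl

open FiniteType (Vec.lookup groups) groupIndex lookup-groupIndex
  renaming (all? to ∀-group?; _≟_ to _≟ᴳ_)

-- rows and columns in the order Z H₁ H₂ W₁ W₂ L₁ L₂
costTable : Vec (Vec ℕ 7) 7
costTable = (2 ∷ 3 ∷ 3 ∷ 6 ∷ 6 ∷ 4 ∷ 4 ∷ [])
          ∷ (3 ∷ 2 ∷ 5 ∷ 4 ∷ 7 ∷ 1 ∷ 4 ∷ [])
          ∷ (3 ∷ 5 ∷ 2 ∷ 7 ∷ 4 ∷ 4 ∷ 1 ∷ [])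
          ∷ (6 ∷ 4 ∷ 7 ∷ 2 ∷ 9 ∷ 3 ∷ 6 ∷ [])
          ∷ (6 ∷ 7 ∷ 4 ∷ 9 ∷ 2 ∷ 6 ∷ 3 ∷ [])
          ∷ (4 ∷ 1 ∷ 4 ∷ 3 ∷ 6 ∷ 2 ∷ 4 ∷ [])
          ∷ (4 ∷ 4 ∷ 1 ∷ 6 ∷ 3 ∷ 4 ∷ 2 ∷ [])
          ∷ []

groupCost : Group → Group → ℕ
groupCost γ δ = Vec.lookup (Vec.lookup costTable (groupIndex γ)) (groupIndex δ)

data Role : Set where
  plain : Group → Role
  special₁ special₂ : Role

roleGroup : Role → Group
roleGroup (plain γ) = γ
roleGroup special₁ = L₁
roleGroup special₂ = L₂

roleCost : Role → Role → ℕ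
roleCost special₁ special₂ = 3
roleCost special₂ special₁ = 3
roleCost r s = groupCost (roleGroup r) (roleGroup s)

roleCost-ordinary : ∀ r s → ¬ (r ≡ special₁ × s ≡ special₂) → ¬ (r ≡ special₂ × s ≡ special₁) →
                    roleCost r s ≡ groupCost (roleGroup r) (roleGroup s)
roleCost-ordinary special₁ special₂ not-planted _ = contradiction (refl , refl) not-planted
roleCost-ordinary special₂ special₁ _ not-planted = contradiction (refl , refl) not-planted
roleCost-ordinary (plain _) _ _ _ = refl
roleCost-ordinary special₁ (plain _) _ _ = refl
roleCost-ordinary special₁ special₁ _ _ = refl
roleCost-ordinary special₂ (plain _) _ _ = refl
roleCost-ordinary special₂ special₂ _ _ = refl

roleIndex : Role → Fin 9
roleIndex special₁ = fzero
roleIndex special₂ = fsuc fzero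
roleIndex (plain γ) = fsuc (fsuc (groupIndex γ))

roleOf : Fin 9 → Role
roleOf fzero = special₁
roleOf (fsuc fzero) = special₂
roleOf (fsuc (fsuc i)) = plain (Vec.lookup groups i)

roleOf-roleIndex : ∀ r → roleOf (roleIndex r) ≡ r
roleOf-roleIndex special₁ = refl
roleOf-roleIndex special₂ = refl
roleOf-roleIndex (plain γ) = cong plain (lookup-groupIndex γ)

open FiniteType roleOf roleIndex roleOf-roleIndex using () renaming (all? to ∀-role?)

opaque
  roleCost-sym : ∀ r s → roleCost r s ≡ roleCost s r
  roleCost-sym = from-yes (∀-role? λ r → ∀-role? λ s → roleCost r s ℕ.≟ roleCost s r)

  roleCost-triangle : ∀ r s q → roleCost r s ≤ roleCost r q + roleCost q s
  roleCost-triangle = from-yes (∀-role? λ r → ∀-role? λ s → ∀-role? λ q → roleCost r s ≤? roleCost r q + roleCost q s)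

  roleCost-positive : ∀ r s → 1 ≤ roleCost r s
  roleCost-positive = from-yes (∀-role? λ r → ∀-role? λ s → 1 ≤? roleCost r s)

data Side : Set where
  left right : Side

opposite : Side → Side
opposite left = right
opposite right = left

hubGroup pendantGroup leafGroup : Side → Group
hubGroup left = H₁
hubGroup right = H₂
pendantGroup left = W₁
pendantGroup right = W₂
leafGroup left = L₁
leafGroup right = L₂

∀-side? : {P : Side → Set} → Decidable P → Dec (∀ σ → P σ)
∀-side? {P} P? = map′ (λ { (l , r) left → l ; (l , r) right → r }) (λ h → h left , h right) (P? left ×-dec P? right)

Near : Side → Group → Set
Near σ γ = γ ≡ hubGroup σ ⊎ γ ≡ leafGroup σ

near? : ∀ σ γ → Dec (Near σ γ)
near? σ γ = (γ ≟ᴳ hubGroup σ) ⊎-dec (γ ≟ᴳ leafGroup σ)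

Internal : Group → Set
Internal γ = γ ≡ Z ⊎ γ ≡ H₁ ⊎ γ ≡ H₂

internal? : ∀ γ → Dec (Internal γ)
internal? γ = (γ ≟ᴳ Z) ⊎-dec (γ ≟ᴳ H₁) ⊎-dec (γ ≟ᴳ H₂)

viaHub : Side → Group → ℕ
viaHub σ γ = groupCost γ (hubGroup σ) + groupCost (hubGroup σ) (leafGroup σ)

opaque
  near-disjoint : ∀ σ γ → Near σ γ → ¬ Near (opposite σ) γ
  near-disjoint = from-yes (∀-side? λ σ → ∀-group? λ γ → near? σ γ →-dec ¬? (near? (opposite σ) γ))

  pendant-not-near : ∀ σ τ → ¬ Near τ (pendantGroup σ)
  pendant-not-near = from-yes (∀-side? λ σ → ∀-side? λ τ → ¬? (near? τ (pendantGroup σ)))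

  hub≢leaf : ∀ σ → hubGroup σ ≢ leafGroup σ
  hub≢leaf = from-yes (∀-side? λ σ → ¬? (hubGroup σ ≟ᴳ leafGroup σ))

  root-not-near : ∀ σ → ¬ Near σ Z
  root-not-near = from-yes (∀-side? λ σ → ¬? (near? σ Z))

  leaf-external : ∀ σ → ¬ Internal (leafGroup σ)
  leaf-external = from-yes (∀-side? λ σ → ¬? (internal? (leafGroup σ)))

  pendant-far-from-own-leaves : ∀ σ γ → ¬ Near σ γ → γ ≢ pendantGroup σ →
    9 < groupCost (pendantGroup σ) γ + groupCost γ (leafGroup σ)
  pendant-far-from-own-leaves = from-yes (∀-side? λ σ → ∀-group? λ γ →
    ¬? (near? σ γ) →-dec ¬? (γ ≟ᴳ pendantGroup σ) →-dec
    9 <? groupCost (pendantGroup σ) γ + groupCost γ (leafGroup σ))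

  pendant-far-from-other-leaves : ∀ σ γ → ¬ Near (opposite σ) γ → γ ≢ leafGroup σ → γ ≢ pendantGroup σ →
    9 < groupCost (pendantGroup σ) γ + viaHub (opposite σ) γ
  pendant-far-from-other-leaves = from-yes (∀-side? λ σ → ∀-group? λ γ →
    ¬? (near? (opposite σ) γ) →-dec ¬? (γ ≟ᴳ leafGroup σ) →-dec ¬? (γ ≟ᴳ pendantGroup σ) →-dec
    9 <? groupCost (pendantGroup σ) γ + viaHub (opposite σ) γ)

  leaf-detour-far-from-other-leaves : ∀ σ γ → ¬ Near (opposite σ) γ →
    9 < groupCost (pendantGroup σ) (leafGroup σ) + (groupCost (leafGroup σ) γ + viaHub (opposite σ) γ)
  leaf-detour-far-from-other-leaves = from-yes (∀-side? λ σ → ∀-group? λ γ →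
    ¬? (near? (opposite σ) γ) →-dec
    9 <? groupCost (pendantGroup σ) (leafGroup σ) + (groupCost (leafGroup σ) γ + viaHub (opposite σ) γ))

module Layout (n : ℕ) where

  M : ℕ
  M = 5 + (n + n)

  groupAt : ℕ → Group
  groupAt 0 = Z
  groupAt 1 = H₁
  groupAt 2 = H₂
  groupAt 3 = W₁
  groupAt 4 = W₂
  groupAt (suc (suc (suc (suc (suc j))))) with j <? n
  ... | yes _ = L₁
  ... | no _ = L₂

  groupOf : Fin M → Group
  groupOf u = groupAt (toℕ u)

  z h₁ h₂ w₁ w₂ : Fin M
  z = fzero
  h₁ = fsuc fzero
  h₂ = fsuc (fsuc fzero)
  w₁ = fsuc (fsuc (fsuc fzero))
  w₂ = fsuc (fsuc (fsuc (fsuc fzero)))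

  -- The root has no parent; parentVertex Z = z is a junk value.
  parentVertex : Group → Fin M
  parentVertex L₁ = h₁
  parentVertex L₂ = h₂
  parentVertex _ = z

  parentVertex-internal : ∀ γ → Internal (groupOf (parentVertex γ))
  parentVertex-internal Z = inj₁ refl
  parentVertex-internal H₁ = inj₁ refl
  parentVertex-internal H₂ = inj₁ refl
  parentVertex-internal W₁ = inj₁ refl
  parentVertex-internal W₂ = inj₁ refl
  parentVertex-internal L₁ = inj₂ (inj₁ refl)
  parentVertex-internal L₂ = inj₂ (inj₂ refl)

  parentVertex-≤2 : ∀ γ → toℕ (parentVertex γ) ≤ 2
  parentVertex-≤2 L₁ = s≤s z≤n
  parentVertex-≤2 L₂ = s≤s (s≤s z≤n)
  parentVertex-≤2 Z = z≤n
  parentVertex-≤2 H₁ = z≤n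
  parentVertex-≤2 H₂ = z≤n
  parentVertex-≤2 W₁ = z≤n
  parentVertex-≤2 W₂ = z≤n

  parent-< : ∀ i → toℕ (parentVertex (groupAt (suc i))) < suc i
  parent-< 0 = s≤s z≤n
  parent-< 1 = s≤s z≤n
  parent-< (suc (suc i)) = ≤-trans (s≤s (parentVertex-≤2 _)) (s≤s (s≤s (s≤s z≤n)))

  private
    module P = ParentTree (λ i → fromℕ< (parent-< i))

  T : Tree M
  T = P.tree (4 + (n + n))

  tree-edge : ∀ {u v} → TreeEdge T u v → v ≡ parentVertex (groupOf u) ⊎ u ≡ parentVertex (groupOf v)
  tree-edge {u} {v} e with P.tree-edge⇒child (4 + (n + n)) e
  ... | inj₁ (i , u≡ , v≡) = inj₁ (toℕ-injective (trans v≡ (trans (toℕ-fromℕ< (parent-< i)) (cong (toℕ ∘ parentVertex ∘ groupAt) (sym u≡)))))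
  ... | inj₂ (i , v≡ , u≡) = inj₂ (toℕ-injective (trans u≡ (trans (toℕ-fromℕ< (parent-< i)) (cong (toℕ ∘ parentVertex ∘ groupAt) (sym v≡)))))

  tree-edge-irreflexive : ∀ {u} → ¬ TreeEdge T u u
  tree-edge-irreflexive = P.tree-edge-irreflexive (4 + (n + n))

  child-edge : ∀ {u} → u ≢ z → TreeEdge T u (parentVertex (groupOf u))
  child-edge {fzero} u≢z = contradiction refl u≢z
  child-edge {fsuc u} _ = P.child⇒tree-edge (4 + (n + n)) (toℕ u , refl , sym (toℕ-fromℕ< (parent-< (toℕ u))))

  tree-neighbour : ∀ {u v} → TreeEdge T u v → ¬ Internal (groupOf u) → v ≡ parentVertex (groupOf u)
  tree-neighbour {v = v} e external with tree-edge e
  ... | inj₁ v≡ = v≡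
  ... | inj₂ refl = contradiction (parentVertex-internal (groupOf v)) external

  leafIndex : Side → Fin n → ℕ
  leafIndex left j = 5 + toℕ j
  leafIndex right j = 5 + (n + toℕ j)

  leafIndex-< : ∀ σ j → leafIndex σ j < M
  leafIndex-< left j = s≤s (s≤s (s≤s (s≤s (s≤s (≤-trans (toℕ<n j) (m≤m+n n n))))))
  leafIndex-< right j = s≤s (s≤s (s≤s (s≤s (s≤s (subst (_≤ n + n) (+-suc n (toℕ j)) (+-monoʳ-≤ n (toℕ<n j)))))))

  leaf : Side → Fin n → Fin M
  leaf σ j = fromℕ< (leafIndex-< σ j)

  toℕ-leaf : ∀ σ j → toℕ (leaf σ j) ≡ leafIndex σ j
  toℕ-leaf σ j = toℕ-fromℕ< (leafIndex-< σ j)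

  groupAt-leafIndex : ∀ σ j → groupAt (leafIndex σ j) ≡ leafGroup σ
  groupAt-leafIndex left j with toℕ j <? n
  ... | yes _ = refl
  ... | no j≮n = contradiction (toℕ<n j) j≮n
  groupAt-leafIndex right j with n + toℕ j <? n
  ... | yes n+j<n = contradiction n+j<n (m+n≮m n (toℕ j))
  ... | no _ = refl

  leaf-position : ∀ j → ∃ λ σ → groupAt (5 + j) ≡ leafGroup σ
  leaf-position j with j <? n
  ... | yes _ = left , refl
  ... | no _ = right , refl

  groupOf-leaf : ∀ σ j → groupOf (leaf σ j) ≡ leafGroup σ
  groupOf-leaf σ j = trans (cong groupAt (toℕ-leaf σ j)) (groupAt-leafIndex σ j)

  leaf-injective : ∀ σ {j k} → leaf σ j ≡ leaf σ k → j ≡ k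
  leaf-injective left {j} {k} e = toℕ-injective (suc-injective (suc-injective (suc-injective (suc-injective (suc-injective
    (trans (sym (toℕ-leaf left j)) (trans (cong toℕ e) (toℕ-leaf left k))))))))
  leaf-injective right {j} {k} e = toℕ-injective (+-cancelˡ-≡ (5 + n) (toℕ j) (toℕ k)
    (trans (sym (toℕ-leaf right j)) (trans (cong toℕ e) (toℕ-leaf right k))))

  pendant : Side → Fin M
  pendant left = w₁
  pendant right = w₂

  hub : Side → Fin M
  hub σ = parentVertex (leafGroup σ)

  pendants-differ : ∀ σ → pendant σ ≢ pendant (opposite σ)
  pendants-differ left ()
  pendants-differ right ()

  pendant-unique : ∀ σ {u} → groupOf u ≡ pendantGroup σ → u ≡ pendant σ
  pendant-unique σ {u} g≡ = toℕ-injective (index-unique σ (toℕ u) g≡)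
    where
    index-unique : ∀ σ i → groupAt i ≡ pendantGroup σ → i ≡ toℕ (pendant σ)
    index-unique left 3 _ = refl
    index-unique right 4 _ = refl
    index-unique σ (suc (suc (suc (suc (suc j))))) g≡ with j <? n | σ | g≡
    ... | yes _ | left | ()
    ... | yes _ | right | ()
    ... | no _ | left | ()
    ... | no _ | right | ()
    index-unique left 0 ()
    index-unique left 1 ()
    index-unique left 2 ()
    index-unique left 4 ()
    index-unique right 0 ()
    index-unique right 1 ()
    index-unique right 2 ()
    index-unique right 3 ()

  ≢-via : ∀ {u v γ δ} → groupOf u ≡ γ → groupOf v ≡ δ → γ ≢ δ → u ≢ v
  ≢-via refl gv γ≢δ refl = γ≢δ gv

  leaf-edge : ∀ σ j → TreeEdge T (leaf σ j) (hub σ)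
  leaf-edge σ j = subst (TreeEdge T (leaf σ j) ∘ parentVertex) (groupOf-leaf σ j)
                        (child-edge (≢-via (groupOf-leaf σ j) refl (root-not-near σ ∘ inj₂ ∘ sym)))

  external-no-tree-edge : ∀ {u v} → ¬ Internal (groupOf u) → ¬ Internal (groupOf v) → ¬ TreeEdge T u v
  external-no-tree-edge {u} u-ext v-ext e = v-ext (subst (Internal ∘ groupOf) (sym (tree-neighbour e u-ext)) (parentVertex-internal (groupOf u)))

  baseCost : Cost M
  baseCost = labelledCost groupCost groupOf

  baseInstance : Instance
  baseInstance = M , T , baseCost


  groupOf-pendant : ∀ σ → groupOf (pendant σ) ≡ pendantGroup σ
  groupOf-pendant left = refl
  groupOf-pendant right = refl

  opaque
    pendant-external : ∀ σ → ¬ Internal (groupOf (pendant σ))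
    pendant-external = from-yes (∀-side? λ σ → ¬? (internal? (groupOf (pendant σ))))

  groupOf-hub : ∀ σ → groupOf (hub σ) ≡ hubGroup σ
  groupOf-hub left = refl
  groupOf-hub right = refl

  parentVertex-pendant : ∀ σ → parentVertex (groupOf (pendant σ)) ≡ z
  parentVertex-pendant left = refl
  parentVertex-pendant right = refl

  baseCost-≢ : ∀ {u v} → u ≢ v → baseCost u v ≡ groupCost (groupOf u) (groupOf v)
  baseCost-≢ {u} {v} = labelledCost-≢ groupCost groupOf {u} {v}

  baseCost-via : ∀ u v {γ δ} → groupOf u ≡ γ → groupOf v ≡ δ → γ ≢ δ → baseCost u v ≡ groupCost γ δ
  baseCost-via u v refl refl γ≢δ = baseCost-≢ {u} {v} (γ≢δ ∘ cong groupOf)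

  baseCost-triangle : ∀ u v w → baseCost u v ≤ baseCost u w + baseCost w v
  baseCost-triangle = labelledCost-triangle groupCost groupOf (λ γ δ ε → roleCost-triangle (plain γ) (plain δ) (plain ε))

  baseCost-refl : ∀ u → baseCost u u ≡ 0
  baseCost-refl = labelledCost-refl groupCost groupOf

module BaseLowerBound (n : ℕ) (n≥7 : 7 ≤ n) (S : ShortcutSet (Layout.T n) 3) where
  open Layout n

  shortcut : Fin 3 → Fin M × Fin M
  shortcut = proj₁ S

  E : Fin M → Fin M → Set
  E = AugEdge T S

  Within : ℕ → Fin M → Fin M → Set
  Within B s t = ∃ λ ℓ → Walk E baseCost s t ℓ × ℓ ≤ B

  shortcut-≢ : ∀ {i u v} → Joins (shortcut i) u v → u ≢ v
  shortcut-≢ {i} (inj₁ e) u≡v = proj₁ (proj₁ (proj₂ S) i) (trans (cong proj₁ e) (trans u≡v (sym (cong proj₂ e))))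
  shortcut-≢ {i} (inj₂ e) u≡v = proj₁ (proj₁ (proj₂ S) i) (trans (cong proj₁ e) (trans (sym u≡v) (sym (cong proj₂ e))))

  edge-≢ : ∀ {u v} → E u v → u ≢ v
  edge-≢ (inj₁ e) refl = tree-edge-irreflexive e
  edge-≢ (inj₂ (_ , joins)) = shortcut-≢ joins

  edge-from-external : ∀ {u v} → E u v → ¬ Internal (groupOf u) →
                       v ≡ parentVertex (groupOf u) ⊎ ∃ λ i → Joins (shortcut i) u v
  edge-from-external (inj₁ e) external = inj₁ (tree-neighbour e external)
  edge-from-external (inj₂ joins) _ = inj₂ joins

  Fresh : Fin M → Set
  Fresh u = ∀ i → proj₁ (shortcut i) ≢ u × proj₂ (shortcut i) ≢ u

  fresh-leaf : ∀ σ → ∃ λ j → Fresh (leaf σ j)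
  fresh-leaf σ with unmatched (λ j u → u ≡ leaf σ j) (λ j u → u Finₚ.≟ leaf σ j)
                              (λ e e′ → leaf-injective σ (trans (sym e) e′)) endpoints n≥7
    where
    endpoints : List (Fin M)
    endpoints = proj₁ (shortcut fzero) ∷ proj₂ (shortcut fzero)
              ∷ proj₁ (shortcut (fsuc fzero)) ∷ proj₂ (shortcut (fsuc fzero))
              ∷ proj₁ (shortcut (fsuc (fsuc fzero))) ∷ proj₂ (shortcut (fsuc (fsuc fzero))) ∷ []
  ... | j , (a₁ ∷ b₁ ∷ a₂ ∷ b₂ ∷ a₃ ∷ b₃ ∷ []) = j , λ
    { fzero → a₁ , b₁
    ; (fsuc fzero) → a₂ , b₂
    ; (fsuc (fsuc fzero)) → a₃ , b₃ }

  fresh-entry : ∀ {u h} → Fresh h → ∀ {i} → ¬ Joins (shortcut i) u h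
  fresh-entry fresh {i} (inj₁ e) = proj₂ (fresh i) (cong proj₂ e)
  fresh-entry fresh {i} (inj₂ e) = proj₁ (fresh i) (cong proj₁ e)

  edge-into-fresh-leaf : ∀ σ {h u} → Fresh h → groupOf h ≡ leafGroup σ → E u h → u ≡ hub σ
  edge-into-fresh-leaf σ {u = u} fresh gh (inj₁ e) with tree-edge e
  ... | inj₁ refl = contradiction (subst Internal gh (parentVertex-internal (groupOf u))) (leaf-external σ)
  ... | inj₂ u≡ = trans u≡ (cong parentVertex gh)
  edge-into-fresh-leaf σ fresh gh (inj₂ (_ , joins)) = contradiction joins (fresh-entry fresh)

  walk-lower : ∀ {s t ℓ} → Walk E baseCost s t ℓ → baseCost s t ≤ ℓ
  walk-lower = cost-≤-walk baseCost-triangle baseCost-refl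

  walk-into-fresh-leaf : ∀ σ {h s ℓ} → Fresh h → groupOf h ≡ leafGroup σ → ¬ Near σ (groupOf s) →
                         Walk E baseCost s h ℓ → viaHub σ (groupOf s) ≤ ℓ
  walk-into-fresh-leaf σ {h} {s} {ℓ} fresh gh far walk =
    subst (_≤ ℓ) costs (cost-via-≤-walk baseCost-triangle baseCost-refl (edge-into-fresh-leaf σ fresh gh) walk s≢h)
    where
    s≢h : s ≢ h
    s≢h refl = far (inj₂ gh)
    costs : baseCost s (hub σ) + baseCost (hub σ) h ≡ viaHub σ (groupOf s)
    costs = cong₂ _+_ (baseCost-via s (hub σ) refl (groupOf-hub σ) (far ∘ inj₁))
                      (baseCost-via (hub σ) h (groupOf-hub σ) gh (hub≢leaf σ))

  prefix-≤ : ∀ {x ℓ′ ℓ y} → x + ℓ′ ≡ ℓ → y ≤ ℓ′ → x + y ≤ ℓ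
  prefix-≤ {x} eq y≤ℓ′ = ≤-trans (+-monoʳ-≤ x y≤ℓ′) (≤-reflexive eq)

  over-budget : ∀ {A : Set} {x y} → 9 < x → x ≡ y → y ≤ 9 → A
  over-budget 9<x refl x≤9 = contradiction x≤9 (<⇒≱ 9<x)

  pendant-≢-near : ∀ {σ τ u} → Near τ (groupOf u) → pendant σ ≢ u
  pendant-≢-near {σ} {τ} near refl = pendant-not-near σ τ (subst (Near τ) (groupOf-pendant σ) near)

  record Attachment (σ : Side) : Set where
    field
      index : Fin 3
      end : Fin M
      joins : Joins (shortcut index) (pendant σ) end
      near : Near σ (groupOf end)

  pendant-attached : ∀ σ {h} → Fresh h → groupOf h ≡ leafGroup σ → Within 9 (pendant σ) h → Attachment σ
  pendant-attached σ {h} fresh gh (ℓ , walk , ℓ≤9) with walk-uncons walk (pendant-≢-near (inj₂ gh))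
  ... | v , e , ℓ′ , rest , eq with near? σ (groupOf v) | edge-from-external e (pendant-external σ)
  ...   | yes near | inj₂ (i , joins) = record { index = i ; end = v ; joins = joins ; near = near }
  ...   | yes near | inj₁ v≡ = ⊥-elim (root-not-near σ (subst (Near σ ∘ groupOf) (trans v≡ (parentVertex-pendant σ)) near))
  ...   | no far | _ = over-budget (pendant-far-from-own-leaves σ (groupOf v) far gv≢W)
                         (cong₂ _+_ (sym (baseCost-via (pendant σ) v (groupOf-pendant σ) refl (gv≢W ∘ sym)))
                                    (sym (baseCost-via v h refl gh (far ∘ inj₂))))
                         (≤-trans (prefix-≤ eq (walk-lower rest)) ℓ≤9)
    where
    gv≢W : groupOf v ≢ pendantGroup σ
    gv≢W gv≡W = edge-≢ e (sym (pendant-unique σ gv≡W))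

  record Crossing (σ : Side) : Set where
    field
      index : Fin 3
      start end : Fin M
      joins : Joins (shortcut index) start end
      near : Near (opposite σ) (groupOf end)
      origin : start ≡ pendant σ ⊎ (groupOf start ≡ leafGroup σ × ∃ λ i → Joins (shortcut i) (pendant σ) start)

  leaf-crosses : ∀ σ {h v ℓ′} → Fresh h → groupOf h ≡ leafGroup (opposite σ) → groupOf v ≡ leafGroup σ →
                 (∃ λ i → Joins (shortcut i) (pendant σ) v) →
                 Walk E baseCost v h ℓ′ → baseCost (pendant σ) v + ℓ′ ≤ 9 → Crossing σ
  leaf-crosses σ {h} {v} fresh gh gv attach walk within with walk-uncons walk v≢h
    where
    v≢h : v ≢ h
    v≢h refl = near-disjoint σ (leafGroup σ) (inj₂ refl) (inj₂ (trans (sym gv) gh))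
  ... | v′ , e , ℓ″ , rest , eq with near? (opposite σ) (groupOf v′) | edge-from-external e (subst (¬_ ∘ Internal) (sym gv) (leaf-external σ))
  ...   | yes near | inj₂ (j , joins) =
          record { index = j ; start = v ; end = v′ ; joins = joins ; near = near ; origin = inj₂ (gv , attach) }
  ...   | yes near | inj₁ v′≡ = ⊥-elim (near-disjoint σ (hubGroup σ) (inj₁ refl)
                                   (subst (Near (opposite σ)) (trans (cong groupOf (trans v′≡ (cong parentVertex gv))) (groupOf-hub σ)) near))
  ...   | no far | _ = over-budget (leaf-detour-far-from-other-leaves σ (groupOf v′) far)
                         (cong₂ _+_ (sym (baseCost-via (pendant σ) v (groupOf-pendant σ) gv (pendant-not-near σ σ ∘ inj₂)))
                           (cong (_+ viaHub (opposite σ) (groupOf v′)) (trans (cong (λ γ → groupCost γ (groupOf v′)) (sym gv)) (sym (baseCost-≢ (edge-≢ e))))))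
                         (≤-trans (prefix-≤ refl (prefix-≤ eq (walk-into-fresh-leaf (opposite σ) fresh gh far rest))) within)

  pendant-crosses : ∀ σ {h} → Fresh h → groupOf h ≡ leafGroup (opposite σ) → Within 9 (pendant σ) h → Crossing σ
  pendant-crosses σ {h} fresh gh (ℓ , walk , ℓ≤9) with walk-uncons walk (pendant-≢-near (inj₂ gh))
  ... | v , e , ℓ′ , rest , eq with near? (opposite σ) (groupOf v) | edge-from-external e (pendant-external σ)
  ...   | yes near | inj₂ (i , joins) =
          record { index = i ; start = pendant σ ; end = v ; joins = joins ; near = near ; origin = inj₁ refl }
  ...   | yes near | inj₁ v≡ = ⊥-elim (root-not-near (opposite σ) (subst (Near (opposite σ) ∘ groupOf) (trans v≡ (parentVertex-pendant σ)) near))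
  ...   | no far | edge with groupOf v ≟ᴳ leafGroup σ | edge
  ...     | yes gv | inj₂ attach = leaf-crosses σ fresh gh gv attach rest (≤-trans (≤-reflexive eq) ℓ≤9)
  ...     | yes gv | inj₁ v≡ = ⊥-elim (leaf-external σ (subst Internal gv (subst (Internal ∘ groupOf) (sym (trans v≡ (parentVertex-pendant σ))) (inj₁ refl))))
  ...     | no gv≢L | _ = over-budget (pendant-far-from-other-leaves σ (groupOf v) far gv≢L gv≢W)
                        (cong (_+ viaHub (opposite σ) (groupOf v)) (sym (baseCost-via (pendant σ) v (groupOf-pendant σ) refl (gv≢W ∘ sym))))
                        (≤-trans (prefix-≤ eq (walk-into-fresh-leaf (opposite σ) fresh gh far rest)) ℓ≤9)
    where
    gv≢W : groupOf v ≢ pendantGroup σ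
    gv≢W gv≡W = edge-≢ e (sym (pendant-unique σ gv≡W))

  different-shortcuts : ∀ {i k a b a′ b′} → Joins (shortcut i) a b → Joins (shortcut k) a′ b′ →
                        ¬ (a ≡ a′ × b ≡ b′) → ¬ (a ≡ b′ × b ≡ a′) → i ≢ k
  different-shortcuts jᵢ jₖ no-match no-swap refl with joins-match jᵢ jₖ
  ... | inj₁ m = no-match m
  ... | inj₂ m = no-swap m

  module Chain {i i′ j p q} (w₁p : Joins (shortcut i) w₁ p) (w₂q : Joins (shortcut i′) w₂ q)
                  (pq : Joins (shortcut j) p q) (gp : groupOf p ≡ L₁) (gq : groupOf q ≡ L₂) where

    w₁≢p : w₁ ≢ p
    w₁≢p = ≢-via refl gp λ ()
    w₁≢q : w₁ ≢ q
    w₁≢q = ≢-via refl gq λ ()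
    w₂≢p : w₂ ≢ p
    w₂≢p = ≢-via refl gp λ ()
    w₂≢q : w₂ ≢ q
    w₂≢q = ≢-via refl gq λ ()

    cover : ∀ k → k ≡ i ⊎ k ≡ i′ ⊎ k ≡ j
    cover k = fin3-cover i i′ j k (different-shortcuts w₁p w₂q ((λ ()) ∘ proj₁) (w₁≢q ∘ proj₁))
                                  (different-shortcuts w₁p pq (w₁≢p ∘ proj₁) (w₁≢q ∘ proj₁))
                                  (different-shortcuts w₂q pq (w₂≢p ∘ proj₁) (w₂≢q ∘ proj₁))

    one-of-three : ∀ {k a b} → Joins (shortcut k) a b →
            Joins (shortcut i) a b ⊎ Joins (shortcut i′) a b ⊎ Joins (shortcut j) a b
    one-of-three {k} {a} {b} jk = Sum.map along (Sum.map along along) (cover k)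
      where
      along : ∀ {l} → k ≡ l → Joins (shortcut l) a b
      along k≡l = subst (λ l → Joins (shortcut l) a b) k≡l jk

    w₁-neighbours : ∀ {v} → E w₁ v → v ≡ z ⊎ v ≡ p
    w₁-neighbours e with edge-from-external e (pendant-external left)
    ... | inj₁ v≡z = inj₁ v≡z
    ... | inj₂ (_ , w₁v) with one-of-three w₁v
    ...   | inj₁ w₁v′ = inj₂ (joins-other-end w₁v′ w₁p w₁≢p)
    ...   | inj₂ (inj₁ w₁v′) = ⊥-elim ([ (λ ()) , w₁≢q ]′ (joins-endpoint w₁v′ w₂q))
    ...   | inj₂ (inj₂ w₁v′) = ⊥-elim ([ w₁≢p , w₁≢q ]′ (joins-endpoint w₁v′ pq))

    p-neighbours : ∀ {v} → E p v → v ≡ h₁ ⊎ v ≡ w₁ ⊎ v ≡ q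
    p-neighbours e with edge-from-external e (subst (¬_ ∘ Internal) (sym gp) (leaf-external left))
    ... | inj₁ v≡ = inj₁ (trans v≡ (cong parentVertex gp))
    ... | inj₂ (_ , pv) with one-of-three pv
    ...   | inj₁ pv′ = inj₂ (inj₁ (joins-other-end pv′ (joins-sym w₁p) (w₁≢p ∘ sym)))
    ...   | inj₂ (inj₁ pv′) = ⊥-elim ([ w₂≢p ∘ sym , ≢-via gp gq (λ ()) ]′ (joins-endpoint pv′ w₂q))
    ...   | inj₂ (inj₂ pv′) = inj₂ (inj₂ (joins-other-end pv′ pq (≢-via gp gq (λ ()))))

    w₁p-cost : 3 ≡ baseCost w₁ p
    w₁p-cost = sym (baseCost-via w₁ p refl gp λ ())

    detour-via-p : ∀ {v} → E p v → ¬ baseCost w₁ p + (baseCost p v + baseCost v w₂) ≤ 9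
    detour-via-p e with p-neighbours e
    ... | inj₁ refl = over-budget (from-yes (9 <? 11))
            (cong₂ _+_ w₁p-cost (cong₂ _+_ (sym (baseCost-via p h₁ gp refl λ ())) refl))
    ... | inj₂ (inj₁ refl) = over-budget (from-yes (9 <? 15))
            (cong₂ _+_ w₁p-cost (cong₂ _+_ (sym (baseCost-via p w₁ gp refl λ ())) refl))
    ... | inj₂ (inj₂ refl) = over-budget (from-yes (9 <? 10))
            (cong₂ _+_ w₁p-cost (cong₂ _+_ (sym (baseCost-via p q gp gq λ ())) (sym (baseCost-via q w₂ gq refl λ ()))))

    w₁-far-from-w₂ : ¬ Within 9 w₁ w₂
    w₁-far-from-w₂ (ℓ , walk , ℓ≤9) with walk-uncons walk (λ ())
    ... | v , e , ℓ′ , rest , eq with w₁-neighbours e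
    ...   | inj₁ refl = over-budget (from-yes (9 <? 12)) refl (≤-trans (prefix-≤ eq (walk-lower rest)) ℓ≤9)
    ...   | inj₂ refl with walk-uncons rest (w₂≢p ∘ sym)
    ...     | v′ , e′ , ℓ″ , rest′ , eq′ = detour-via-p e′ (≤-trans (prefix-≤ eq (prefix-≤ eq′ (walk-lower rest′))) ℓ≤9)

  open Attachment
  open Crossing

  attachments-differ : (A₁ : Attachment left) (A₂ : Attachment right) → index A₁ ≢ index A₂
  attachments-differ A₁ A₂ = different-shortcuts (joins A₁) (joins A₂) ((λ ()) ∘ proj₁) (pendant-≢-near {left} (near A₂) ∘ proj₁)

  attachment≢crossing : ∀ σ (A : Attachment σ) (C : Crossing σ) → index A ≢ index C
  attachment≢crossing σ A C = different-shortcuts (joins A) (joins C)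
    (λ (_ , e) → near-disjoint σ _ (near A) (subst (Near (opposite σ) ∘ groupOf) (sym e) (near C)))
    (pendant-≢-near (near C) ∘ proj₁)

  attachment≢opposite-crossing : ∀ σ (A : Attachment σ) (C : Crossing (opposite σ)) → index A ≢ index C
  attachment≢opposite-crossing σ A C = different-shortcuts (joins A) (joins C) (not-start ∘ proj₁) (pendant-≢-near (near C) ∘ proj₁)
    where
    not-start : pendant σ ≢ start C
    not-start w≡s with origin C
    ... | inj₁ s≡w = pendants-differ σ (trans w≡s s≡w)
    ... | inj₂ (gs , _) = pendant-not-near σ (opposite σ) (inj₂ (trans (sym (groupOf-pendant σ)) (trans (cong groupOf w≡s) gs)))

  crossings-meet : Attachment left → Attachment right → Crossing left → Crossing right → ¬ Within 9 w₁ w₂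
  crossings-meet A₁ A₂ C₁ C₂ short with fin3-cover (index A₁) (index A₂) (index C₁) (index C₂)
                                    (attachments-differ A₁ A₂) (attachment≢crossing left A₁ C₁)
                                    (attachment≢opposite-crossing right A₂ C₁)
  ... | inj₁ e = attachment≢opposite-crossing left A₁ C₂ (sym e)
  ... | inj₂ (inj₁ e) = attachment≢crossing right A₂ C₂ (sym e)
  ... | inj₂ (inj₂ same) with joins-match (joins C₁) (subst (λ k → Joins (shortcut k) (start C₂) (end C₂)) same (joins C₂))
  ...   | inj₁ (_ , e) = near-disjoint right _ (near C₁) (subst (Near left ∘ groupOf) (sym e) (near C₂))
  ...   | inj₂ (s₁≡e₂ , e₁≡s₂) with origin C₁ | origin C₂
  ...     | inj₁ refl | _ = pendant-not-near left left (subst (Near left ∘ groupOf) (sym s₁≡e₂) (near C₂))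
  ...     | inj₂ _ | inj₁ refl = pendant-not-near right right (subst (Near right ∘ groupOf) e₁≡s₂ (near C₁))
  ...     | inj₂ (g₁ , _ , w₁p) | inj₂ (g₂ , _ , w₂q) =
            Chain.w₁-far-from-w₂ w₁p w₂q (subst (Joins (shortcut (index C₁)) (start C₁)) e₁≡s₂ (joins C₁)) g₁ g₂ short

  ¬diam≤9 : ¬ DiamAtMost E baseCost 9
  ¬diam≤9 diam with fresh-leaf left | fresh-leaf right
  ... | a , fresh-a | b , fresh-b =
    crossings-meet (pendant-attached left fresh-a (groupOf-leaf left a) (diam w₁ (leaf left a)))
                   (pendant-attached right fresh-b (groupOf-leaf right b) (diam w₂ (leaf right b)))
                   (pendant-crosses left fresh-b (groupOf-leaf right b) (diam w₁ (leaf right b)))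
                   (pendant-crosses right fresh-a (groupOf-leaf left a) (diam w₂ (leaf left a)))
                   (diam w₁ w₂)

module Planted (n : ℕ) (a b : Fin n) where
  open Layout n

  α β : Fin M
  α = leaf left a
  β = leaf right b

  α≢β : α ≢ β
  α≢β = ≢-via (groupOf-leaf left a) (groupOf-leaf right b) λ ()

  role : Fin M → Role
  role u with u Finₚ.≟ α | u Finₚ.≟ β
  ... | yes _ | _ = special₁
  ... | no _ | yes _ = special₂
  ... | no _ | no _ = plain (groupOf u)

  role-α : role α ≡ special₁
  role-α with α Finₚ.≟ α
  ... | yes _ = refl
  ... | no α≢α = contradiction refl α≢α

  role-β : role β ≡ special₂
  role-β with β Finₚ.≟ α | β Finₚ.≟ β
  ... | yes β≡α | _ = contradiction (sym β≡α) α≢β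
  ... | no _ | yes _ = refl
  ... | no _ | no β≢β = contradiction refl β≢β

  role-plain : ∀ {u} → u ≢ α → u ≢ β → role u ≡ plain (groupOf u)
  role-plain {u} u≢α u≢β with u Finₚ.≟ α | u Finₚ.≟ β
  ... | yes u≡α | _ = contradiction u≡α u≢α
  ... | no _ | yes u≡β = contradiction u≡β u≢β
  ... | no _ | no _ = refl

  role-special₁ : ∀ {u} → role u ≡ special₁ → u ≡ α
  role-special₁ {u} with u Finₚ.≟ α | u Finₚ.≟ β
  ... | yes u≡α | _ = λ _ → u≡α
  ... | no _ | yes _ = λ ()
  ... | no _ | no _ = λ ()

  role-special₂ : ∀ {u} → role u ≡ special₂ → u ≡ β
  role-special₂ {u} with u Finₚ.≟ α | u Finₚ.≟ β
  ... | yes _ | _ = λ ()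
  ... | no _ | yes u≡β = λ _ → u≡β
  ... | no _ | no _ = λ ()

  roleGroup-role : ∀ u → roleGroup (role u) ≡ groupOf u
  roleGroup-role u with u Finₚ.≟ α | u Finₚ.≟ β
  ... | yes refl | _ = sym (groupOf-leaf left a)
  ... | no _ | yes refl = sym (groupOf-leaf right b)
  ... | no _ | no _ = refl

  plantedCost : Cost M
  plantedCost = labelledCost roleCost role

  plantedInstance : Instance
  plantedInstance = M , T , plantedCost

  plantedCost-agrees : ∀ {u v} → ¬ Joins (α , β) u v → plantedCost u v ≡ baseCost u v
  plantedCost-agrees {u} {v} not-planted = by-cases (u Finₚ.≟ v)
    where
    open ≡-Reasoning
    by-cases : Dec (u ≡ v) → plantedCost u v ≡ baseCost u v
    by-cases (yes refl) = trans (labelledCost-refl roleCost role u) (sym (baseCost-refl u))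
    by-cases (no u≢v) = begin
      plantedCost u v                                     ≡⟨ labelledCost-≢ roleCost role {u} {v} u≢v ⟩
      roleCost (role u) (role v)                          ≡⟨ roleCost-ordinary (role u) (role v)
          (λ (r₁ , r₂) → not-planted (inj₁ (sym (cong₂ _,_ (role-special₁ r₁) (role-special₂ r₂)))))
          (λ (r₂ , r₁) → not-planted (inj₂ (sym (cong₂ _,_ (role-special₁ r₁) (role-special₂ r₂))))) ⟩
      groupCost (roleGroup (role u)) (roleGroup (role v)) ≡⟨ cong₂ groupCost (roleGroup-role u) (roleGroup-role v) ⟩
      groupCost (groupOf u) (groupOf v)                   ≡⟨ baseCost-≢ u≢v ⟨
      baseCost u v                                        ∎

  plantedShortcut : Fin 3 → Fin M × Fin M
  plantedShortcut fzero = w₁ , α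
  plantedShortcut (fsuc fzero) = w₂ , β
  plantedShortcut (fsuc (fsuc fzero)) = α , β

  pairGroups : Fin M × Fin M → Group × Group
  pairGroups = Product.map groupOf groupOf

  plantedGroups : Fin 3 → Group × Group
  plantedGroups fzero = W₁ , L₁
  plantedGroups (fsuc fzero) = W₂ , L₂
  plantedGroups (fsuc (fsuc fzero)) = L₁ , L₂

  pairGroups-planted : ∀ i → pairGroups (plantedShortcut i) ≡ plantedGroups i
  pairGroups-planted fzero = cong (W₁ ,_) (groupOf-leaf left a)
  pairGroups-planted (fsuc fzero) = cong (W₂ ,_) (groupOf-leaf right b)
  pairGroups-planted (fsuc (fsuc fzero)) = cong₂ _,_ (groupOf-leaf left a) (groupOf-leaf right b)

  opaque
    plantedGroups-external : ∀ i → let (γ , δ) = plantedGroups i in γ ≢ δ × ¬ Internal γ × ¬ Internal δ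
    plantedGroups-external = from-yes (Finₚ.all? λ i → let (γ , δ) = plantedGroups i in
      ¬? (γ ≟ᴳ δ) ×-dec ¬? (internal? γ) ×-dec ¬? (internal? δ))

    plantedGroups-distinct : ∀ i j → i ≢ j → plantedGroups i ≢ plantedGroups j × plantedGroups i ≢ Product.swap (plantedGroups j)
    plantedGroups-distinct = from-yes (Finₚ.all? λ i → Finₚ.all? λ j → ¬? (i Finₚ.≟ j) →-dec
      (¬? (≡-dec _≟ᴳ_ _≟ᴳ_ (plantedGroups i) (plantedGroups j)) ×-dec ¬? (≡-dec _≟ᴳ_ _≟ᴳ_ (plantedGroups i) (Product.swap (plantedGroups j)))))

  plantedShortcuts : ShortcutSet T 3
  plantedShortcuts = plantedShortcut , is-shortcut , distinct
    where
    is-shortcut : ∀ i → IsShortcut T (plantedShortcut i)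
    is-shortcut i with plantedGroups-external i
    ... | γ≢δ , γ-ext , δ-ext =
      ≢-via g₁ g₂ γ≢δ , external-no-tree-edge (γ-ext ∘ subst Internal g₁) (δ-ext ∘ subst Internal g₂)
      where
      g₁ : groupOf (proj₁ (plantedShortcut i)) ≡ proj₁ (plantedGroups i)
      g₁ = cong proj₁ (pairGroups-planted i)
      g₂ : groupOf (proj₂ (plantedShortcut i)) ≡ proj₂ (plantedGroups i)
      g₂ = cong proj₂ (pairGroups-planted i)
    distinct : ∀ i j → i ≢ j → (plantedShortcut i ≢ plantedShortcut j) × (plantedShortcut i ≢ swap (plantedShortcut j))
    distinct i j i≢j with plantedGroups-distinct i j i≢j
    ... | differ , differ-swapped =
      (λ e → differ (trans (sym (pairGroups-planted i)) (trans (cong pairGroups e) (pairGroups-planted j)))) ,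
      (λ e → differ-swapped (trans (sym (pairGroups-planted i)) (trans (cong pairGroups e) (cong Product.swap (pairGroups-planted j)))))

  E : Fin M → Fin M → Set
  E = AugEdge T plantedShortcuts

  E-sym : ∀ {u v} → E u v → E v u
  E-sym = aug-edge-sym {T = T} {S = plantedShortcuts}

  Within : ℕ → Fin M → Fin M → Set
  Within B s t = ∃ λ ℓ → Walk E plantedCost s t ℓ × ℓ ≤ B

  stay : ∀ {t} → Within 0 t t
  stay = 0 , here , z≤n

  hop : ∀ {u v t r s B} → role u ≡ r → role v ≡ s → E u v → Within B v t → Within (roleCost r s + B) u t
  hop {u} {v} refl refl e (ℓ , walk , ℓ≤B) = _ , step e walk , +-mono-≤ (labelledCost-≤ roleCost role u v) ℓ≤B

  meet : ∀ {u v t B₁ B₂} → Within B₁ u t → Within B₂ v t → Within (B₁ + B₂) u v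
  meet (ℓ₁ , p₁ , ℓ₁≤B₁) (ℓ₂ , p₂ , ℓ₂≤B₂) =
    ℓ₁ + ℓ₂ , walk-++ p₁ (walk-reverse E-sym (labelledCost-sym roleCost role roleCost-sym) p₂) , +-mono-≤ ℓ₁≤B₁ ℓ₂≤B₂

  relax : ∀ {u t B B′} → B ≤ B′ → Within B u t → Within B′ u t
  relax B≤B′ (ℓ , p , ℓ≤B) = ℓ , p , ≤-trans ℓ≤B B≤B′

  h₁α : E h₁ α
  h₁α = E-sym (inj₁ (leaf-edge left a))

  h₂β : E h₂ β
  h₂β = E-sym (inj₁ (leaf-edge right b))

  w₁α : E w₁ α
  w₁α = inj₂ (fzero , inj₁ refl)

  w₂β : E w₂ β
  w₂β = inj₂ (fsuc fzero , inj₁ refl)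

  αβ : E α β
  αβ = inj₂ (fsuc (fsuc fzero) , inj₁ refl)

  toα toβ : Role → ℕ
  toα special₁ = 0
  toα special₂ = 3
  toα (plain Z) = 4
  toα (plain H₁) = 1
  toα (plain H₂) = 4
  toα (plain W₁) = 3
  toα (plain W₂) = 6
  toα (plain L₁) = 2
  toα (plain L₂) = 5
  toβ special₁ = 3
  toβ special₂ = 0
  toβ (plain Z) = 4
  toβ (plain H₁) = 4
  toβ (plain H₂) = 1
  toβ (plain W₁) = 6
  toβ (plain W₂) = 3
  toβ (plain L₁) = 5
  toβ (plain L₂) = 2

  opaque
    hubs-cover : ∀ r s → toα r + toα s ≤ 9 ⊎ toβ r + toβ s ≤ 9
    hubs-cover = from-yes (∀-role? λ r → ∀-role? λ s → (toα r + toα s ≤? 9) ⊎-dec (toβ r + toβ s ≤? 9))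

  Routes : Role → Fin M → Set
  Routes r u = Within (toα r) u α × Within (toβ r) u β

  α-routes : Routes special₁ α
  α-routes = stay , hop role-α role-β αβ stay

  β-routes : Routes special₂ β
  β-routes = hop role-β role-α (E-sym αβ) stay , stay

  leaf-routes : ∀ σ {u} → u ≢ z → groupOf u ≡ leafGroup σ → role u ≡ plain (leafGroup σ) → Routes (plain (leafGroup σ)) u
  leaf-routes left {u} u≢z gu ru =
      hop ru refl to-hub (hop refl role-α h₁α stay)
    , hop ru refl to-hub (hop refl role-α h₁α (hop role-α role-β αβ stay))
    where
    to-hub : E u h₁
    to-hub = inj₁ (subst (TreeEdge T u ∘ parentVertex) gu (child-edge u≢z))
  leaf-routes right {u} u≢z gu ru =
      hop ru refl to-hub (hop refl role-β h₂β (hop role-β role-α (E-sym αβ) stay))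
    , hop ru refl to-hub (hop refl role-β h₂β stay)
    where
    to-hub : E u h₂
    to-hub = inj₁ (subst (TreeEdge T u ∘ parentVertex) gu (child-edge u≢z))

  plain-routes : ∀ u → u ≢ α → u ≢ β → Routes (plain (groupOf u)) u
  plain-routes fzero _ _ =
      hop refl refl (E-sym (inj₁ (child-edge {h₁} λ ()))) (hop refl role-α h₁α stay)
    , hop refl refl (E-sym (inj₁ (child-edge {h₂} λ ()))) (hop refl role-β h₂β stay)
  plain-routes (fsuc fzero) _ _ = hop refl role-α h₁α stay , hop refl role-α h₁α (hop role-α role-β αβ stay)
  plain-routes (fsuc (fsuc fzero)) _ _ = hop refl role-β h₂β (hop role-β role-α (E-sym αβ) stay) , hop refl role-β h₂β stay
  plain-routes (fsuc (fsuc (fsuc fzero))) _ _ = hop refl role-α w₁α stay , hop refl role-α w₁α (hop role-α role-β αβ stay)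
  plain-routes (fsuc (fsuc (fsuc (fsuc fzero)))) _ _ =
    hop refl role-β w₂β (hop role-β role-α (E-sym αβ) stay) , hop refl role-β w₂β stay
  plain-routes u@(fsuc (fsuc (fsuc (fsuc (fsuc r))))) u≢α u≢β with leaf-position (toℕ r)
  ... | σ , gu = subst (λ γ → Routes (plain γ) u) (sym gu)
                       (leaf-routes σ (λ ()) gu (trans (role-plain u≢α u≢β) (cong plain gu)))

  routes : ∀ u → Routes (role u) u
  routes u with u Finₚ.≟ α | u Finₚ.≟ β
  ... | yes refl | _ = α-routes
  ... | no _ | yes refl = β-routes
  ... | no u≢α | no u≢β = plain-routes u u≢α u≢β

  diam≤9 : DiamAtMost E plantedCost 9
  diam≤9 u v with hubs-cover (role u) (role v)
  ... | inj₁ via-α = relax via-α (meet (proj₁ (routes u)) (proj₁ (routes v)))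
  ... | inj₂ via-β = relax via-β (meet (proj₂ (routes u)) (proj₂ (routes v)))

  planted-admits : Admits 3 9 plantedInstance
  planted-admits = plantedShortcuts , diam≤9

  joins? : ∀ u v → Dec (Joins (α , β) u v)
  joins? u v = ≡-dec Finₚ._≟_ Finₚ._≟_ (α , β) (u , v) ⊎-dec ≡-dec Finₚ._≟_ Finₚ._≟_ (α , β) (v , u)

  planted-pair : ∀ {u v} → plantedCost u v ≢ baseCost u v → Joins (α , β) u v
  planted-pair {u} {v} differ = decidable-stable (joins? u v) (differ ∘ plantedCost-agrees)

instances : ℕ → Instance → Set
instances n I = I ≡ Layout.baseInstance n ⊎ ∃₂ λ a b → I ≡ Planted.plantedInstance n a b

instances-good : ∀ n I → instances n I → GoodInstance I
instances-good n I (inj₁ refl) = labelledCost-good groupCost (Layout.groupOf n)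
  (λ γ δ → roleCost-sym (plain γ) (plain δ)) (λ γ δ ε → roleCost-triangle (plain γ) (plain δ) (plain ε))
  (λ γ δ → roleCost-positive (plain γ) (plain δ)) (Layout.T n)
instances-good n I (inj₂ (a , b , refl)) = labelledCost-good roleCost (Planted.role n a b)
  roleCost-sym roleCost-triangle roleCost-positive (Layout.T n)

module _ (n : ℕ) where
  open Layout n

  plantedAt : Fin (n * n) → Cost M
  plantedAt i = Planted.plantedCost n (proj₁ (remQuot {n} n i)) (proj₂ (remQuot {n} n i))

  plantedAt-separated : ∀ {i j u v} → plantedAt i u v ≢ baseCost u v → plantedAt j u v ≢ baseCost u v → i ≡ j
  plantedAt-separated {i} {j} {u} {v} differᵢ differⱼ
    with joins-same-ends (Planted.planted-pair n _ _ {u} {v} differᵢ) (Planted.planted-pair n _ _ {u} {v} differⱼ)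
  ... | inj₁ same = remQuot-injective (cong₂ _,_ (leaf-injective left (cong proj₁ same)) (leaf-injective right (cong proj₂ same)))
    where
    remQuot-injective : remQuot {n} n i ≡ remQuot n j → i ≡ j
    remQuot-injective e = trans (sym (combine-remQuot {n} n i)) (trans (cong (uncurry combine) e) (combine-remQuot {n} n j))
  ... | inj₂ swapped = ⊥-elim (≢-via (groupOf-leaf left _) (groupOf-leaf right _) (λ ()) (cong proj₁ swapped))

  no-fast-decider : 7 ≤ n → ∀ {Q} → Q < n * n → ∀ A → ¬ DecidesWith A (instances n) 3 9 Q
  no-fast-decider n≥7 Q<n² A decides = BaseLowerBound.¬diam≤9 n n≥7 (proj₁ base-admits) (proj₂ base-admits)
    where
    D : DTree M
    D = A M T
    fooled : ∃ λ i → run D (plantedAt i) ≡ run D baseCost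
    fooled = adversary D baseCost plantedAt (λ {i} {j} {u} {v} → plantedAt-separated {i} {j} {u} {v})
                       (≤-<-trans (proj₁ (decides baseInstance (inj₁ refl))) Q<n²)
    planted-accepted : ∀ i → proj₁ (run D (plantedAt i)) ≡ true
    planted-accepted i = let (a , b) = remQuot {n} n i in
      proj₂ (proj₂ (decides (Planted.plantedInstance n a b) (inj₂ (a , b , refl)))) (Planted.planted-admits n a b)
    base-admits : Admits 3 9 baseInstance
    base-admits = proj₁ (proj₂ (decides baseInstance (inj₁ refl)))
                        (trans (cong proj₁ (sym (proj₂ fooled))) (planted-accepted (proj₁ fooled)))

half-< : ∀ {x y} → 2 * x ≤ y → 0 < y → x < y
half-< {zero} _ 0<y = 0<y
half-< {suc x} {y} 2x≤y _ = <-≤-trans (m<m+n (suc x) (s≤s z≤n)) (subst (_≤ y) (cong (suc x +_) (+-identityʳ (suc x))) 2x≤y)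

size-bounds : ∀ n → 7 ≤ n → n ≤ 1 * Layout.M n × Layout.M n ≤ 7 * n
size-bounds n n≥7 = ≤-trans (≤-trans (m≤m+n n n) (m≤n+m (n + n) 5)) (m≤m+n _ 0)
                   , ≤-trans (+-monoˡ-≤ (n + n) (≤-trans (s≤s (s≤s (s≤s (s≤s (s≤s z≤n))))) n≥7))
                             (+-monoʳ-≤ n (+-monoʳ-≤ n (m≤m+n n _)))

lemma1 : Σ (ℕ → Instance → Set) λ G → Σ ℕ λ n₀ → Σ ℕ λ a → Σ ℕ λ b →
    ((n : ℕ) → n₀ ≤ n → (I : Instance) → G n I →
      GoodInstance I × n ≤ a * size I × size I ≤ b * n) ×
    ((q : ℕ → ℕ) → LittleOSquare q → Σ ℕ λ N → (n : ℕ) → n₀ ≤ n → N ≤ n →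
      (A : Algorithm) → ¬ DecidesWith A (G n) 3 9 (q n))
lemma1 = instances , 7 , 1 , 7 , well-formed , hard
  where
  well-formed : ∀ n → 7 ≤ n → ∀ I → instances n I → GoodInstance I × n ≤ 1 * size I × size I ≤ 7 * n
  well-formed n n≥7 I (inj₁ refl) = instances-good n I (inj₁ refl) , size-bounds n n≥7
  well-formed n n≥7 I (inj₂ (a , b , refl)) = instances-good n I (inj₂ (a , b , refl)) , size-bounds n n≥7

  hard : ∀ q → LittleOSquare q → Σ ℕ λ N → ∀ n → 7 ≤ n → N ≤ n → ∀ A → ¬ DecidesWith A (instances n) 3 9 (q n)
  hard q q-small = proj₁ (q-small 2 (s≤s z≤n)) , λ n n≥7 N≤n →
    no-fast-decider n n≥7 (half-< (proj₂ (q-small 2 (s≤s z≤n)) n N≤n) (square-positive (≤-trans (s≤s z≤n) n≥7)))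
    where
    square-positive : ∀ {n} → 1 ≤ n → 0 < n * n
    square-positive {suc _} _ = s≤s z≤n
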